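{- Let $\mathbf P=(P,\leq,{}',0,1)$ be an orthogonal lub-complete poset and consider the conditions: (i) $\mathbf P$ is a Boolean poset (with ${}'$ its complementation); (ii) for all $x,y\in P$, $x\rightarrow_C y=\{1\}$ implies $x\leq y$; (iii) $\mathbf P$ is a weakly Boolean paraorthomodular poset. Then (i) implies (ii) and (ii) implies (iii).
   Context: For a poset $(P,\leq)$ and $A\subseteq P$: $L(A)=\{x: x\leq a\ \forall a\in A\}$, $U(A)=\{x: a\leq x\ \forall a\in A\}$, $L(x,y)=L(\{x,y\})$, $U(x,y)=U(\{x,y\})$, $LU(A)=L(U(A))$; $\operatorname{Min}A$ is the set of minimal elements of $A$. Statements like $x\vee y=1$ or $x\wedge y=0$ mean the supremum/infimum exists and equals $1$/$0$. A bounded poset $(P,\leq,{}',0,1)$ with antitone involution: $x\leq y\Rightarrow y'\leq x'$, $x''=x$. $x\perp y$ iff $x\leq y'$. Orthogonal: $x\perp y$ implies $x\vee y$ exists. Lub-complete: for every finite $M\subseteq P$ and lower bound $x$ of $M$ there is a maximal element of $L(M)$ above $x$. Boolean poset: distributive ($L(U(x,y),z)=LU(L(x,z),L(y,z))$ for all $x,y,z$) and complemented (each $x$ has $y$ with $L(x,y)=L(P)$, $U(x,y)=U(P)$); complements are unique and ${}'$ is this complementation. Weakly Boolean: for all $a,b$, $a\wedge b=0$ and $a\wedge b'=0$ imply $a=0$. Paraorthomodular: $x\leq y$ and $x'\wedge y=0$ imply $x=y$. Classical implication: $x\rightarrow_C y=\operatorname{Min}U(x',y)$. -}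

module Defs where

open import Level using (Level; _⊔_; suc; Lift)
open import Data.Product using (Σ; ∃; _×_; _,_)
open import Data.Sum using (_⊎_)
open import Data.Unit using (⊤)
open import Data.List using (List)
open import Data.List.Membership.Propositional using (_∈_)
open import Relation.Binary.PropositionalEquality using (_≡_)
open import Relation.Unary using (Pred; _≐_; ｛_｝)

-- Bounded poset with an antitone involution (P, ≤, ′, 0, 1);
-- equality of elements is propositional equality.
record BPAI (c ℓ : Level) : Set (suc (c ⊔ ℓ)) where
  infix 4 _≤_
  infix 10 _′
  field
    Carrier : Set c
    _≤_     : Carrier → Carrier → Set ℓ
    ≤-refl  : ∀ {x} → x ≤ x
    ≤-trans : ∀ {x y z} → x ≤ y → y ≤ z → x ≤ z
    ≤-antisym : ∀ {x y} → x ≤ y → y ≤ x → x ≡ y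
    𝟘 𝟙     : Carrier
    𝟘-min   : ∀ x → 𝟘 ≤ x
    𝟙-max   : ∀ x → x ≤ 𝟙
    _′      : Carrier → Carrier
    antitone : ∀ {x y} → x ≤ y → y ′ ≤ x ′
    involutive : ∀ x → (x ′) ′ ≡ x

module _ {c ℓ : Level} (P : BPAI c ℓ) where
  open BPAI P

  Sub : Set (suc (c ⊔ ℓ))
  Sub = Pred Carrier (c ⊔ ℓ)

  Lo : ∀ {a} → Pred Carrier a → Pred Carrier (c ⊔ ℓ ⊔ a)
  Lo A x = ∀ y → A y → x ≤ y

  Up : ∀ {a} → Pred Carrier a → Pred Carrier (c ⊔ ℓ ⊔ a)
  Up A x = ∀ y → A y → y ≤ x

  pair : Carrier → Carrier → Pred Carrier c
  pair x y z = z ≡ x ⊎ z ≡ y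

  _∪₁_ : ∀ {a} → Pred Carrier a → Carrier → Pred Carrier (c ⊔ a)
  (A ∪₁ z) w = A w ⊎ w ≡ z

  _∪₂_ : ∀ {a} → Pred Carrier a → Pred Carrier a → Pred Carrier a
  (A ∪₂ B) w = A w ⊎ B w

  L₂ : Carrier → Carrier → Pred Carrier (c ⊔ ℓ)
  L₂ x y = Lo (pair x y)

  U₂ : Carrier → Carrier → Pred Carrier (c ⊔ ℓ)
  U₂ x y = Up (pair x y)

  Whole : Pred Carrier c
  Whole _ = Lift c ⊤

  Min : ∀ {a} → Pred Carrier a → Pred Carrier (c ⊔ ℓ ⊔ a)
  Min A x = A x × (∀ y → A y → y ≤ x → y ≡ x)

  IsSup : Carrier → Carrier → Carrier → Set (c ⊔ ℓ)
  IsSup x y z = U₂ x y z × (∀ w → U₂ x y w → z ≤ w)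

  IsInf : Carrier → Carrier → Carrier → Set (c ⊔ ℓ)
  IsInf x y z = L₂ x y z × (∀ w → L₂ x y w → w ≤ z)

  _⊥_ : Carrier → Carrier → Set ℓ
  x ⊥ y = x ≤ y ′

  Orthogonal : Set (c ⊔ ℓ)
  Orthogonal = ∀ x y → x ⊥ y → ∃ λ z → IsSup x y z

  -- finite subsets M given as lists; L(M) as a predicate
  LList : List Carrier → Pred Carrier (c ⊔ ℓ)
  LList M = Lo (λ y → y ∈ M)

  LubComplete : Set (c ⊔ ℓ)
  LubComplete = ∀ (M : List Carrier) x → LList M x →
    ∃ λ m → (m ∈′ Max (LList M)) × x ≤ m
    where
    Max : Pred Carrier (c ⊔ ℓ) → Pred Carrier (c ⊔ ℓ)
    Max A m = A m × (∀ w → A w → m ≤ w → w ≡ m)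
    _∈′_ : Carrier → Pred Carrier (c ⊔ ℓ) → Set (c ⊔ ℓ)
    m ∈′ A = A m

  Distributive : Set (c ⊔ ℓ)
  Distributive = ∀ x y z →
    Lo (U₂ x y ∪₁ z) ≐ Lo (Up (L₂ x z ∪₂ L₂ y z))

  IsComplement : Carrier → Carrier → Set (c ⊔ ℓ)
  IsComplement x y = (L₂ x y ≐ Lo Whole) × (U₂ x y ≐ Up Whole)

  Complemented : Set (c ⊔ ℓ)
  Complemented = ∀ x → ∃ λ y → IsComplement x y

  BooleanWith′ : Set (c ⊔ ℓ)
  BooleanWith′ = Distributive × Complemented × (∀ x → IsComplement x (x ′))

  →C : Carrier → Carrier → Pred Carrier (c ⊔ ℓ)
  →C x y = Min (U₂ (x ′) y)

  CondII : Set (c ⊔ ℓ)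
  CondII = ∀ x y → →C x y ≐ ｛ 𝟙 ｝ → x ≤ y

  WeaklyBoolean : Set (c ⊔ ℓ)
  WeaklyBoolean = ∀ a b → IsInf a b 𝟘 → IsInf a (b ′) 𝟘 → a ≡ 𝟘

  Paraorthomodular : Set (c ⊔ ℓ)
  Paraorthomodular = ∀ x y → x ≤ y → IsInf (x ′) y 𝟘 → x ≡ y

-- Boolean ⇒ (ii): if U(x′, y) = {1}, distributivity gives L(U(x′, y), x) = LU(L(x′, x), L(y, x)),
-- and the left side contains x while y bounds L(x′, x) = L(P) and L(y, x) from above.
-- (ii) ⇒ (iii): if a ∧ b = 0 then, by De Morgan, U(a′, b′) = {1}, so (ii) forces a ≤ b′.
-- Hence a ∧ b′ = 0 gives a ≤ b, so a ≤ a ∧ b, which is weak Booleanity; and x′ ∧ y = 0 gives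
-- x′ ≤ y′, i.e. y ≤ x, which is paraorthomodularity.
module Submission where

open import Defs
open import Level using (Level; _⊔_; lift)
open import Data.Product using (_×_; _,_; proj₁; proj₂)
open import Data.Sum using (inj₁; inj₂)
open import Data.Unit using (tt)
open import Relation.Binary.PropositionalEquality using (_≡_; refl; sym; subst)
open import Relation.Unary using (_≐_; ｛_｝)

module _ {c ℓ : Level} (P : BPAI c ℓ) where
  open BPAI P

  L₂-intro : ∀ {x y w} → w ≤ x → w ≤ y → L₂ P x y w
  L₂-intro p _ _ (inj₁ refl) = p
  L₂-intro _ q _ (inj₂ refl) = q

  L₂-comm : ∀ {x y w} → L₂ P x y w → L₂ P y x w
  L₂-comm l _ (inj₁ refl) = l _ (inj₂ refl)
  L₂-comm l _ (inj₂ refl) = l _ (inj₁ refl)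

  ′-flipˡ : ∀ {x y} → x ′ ≤ y → y ′ ≤ x
  ′-flipˡ {x} p = subst (_ ≤_) (involutive x) (antitone p)

  ′-flipʳ : ∀ {x y} → x ≤ y ′ → y ≤ x ′
  ′-flipʳ {x} {y} p = subst (_≤ x ′) (involutive y) (antitone p)

  𝟘′≡𝟙 : 𝟘 ′ ≡ 𝟙
  𝟘′≡𝟙 = ≤-antisym (𝟙-max (𝟘 ′)) (′-flipʳ (𝟘-min (𝟙 ′)))

  -- a ∧ b = 0 (the lower-bound half of IsInf a b 𝟘 is automatic)
  Disjoint : Carrier → Carrier → Set (c ⊔ ℓ)
  Disjoint a b = ∀ w → L₂ P a b w → w ≤ 𝟘

  Disjoint⇒U₂-′≡𝟙 : ∀ {a b} → Disjoint a b → ∀ w → U₂ P (a ′) (b ′) w → w ≡ 𝟙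
  Disjoint⇒U₂-′≡𝟙 a∧b≡𝟘 w u = ≤-antisym (𝟙-max w) (subst (_≤ w) 𝟘′≡𝟙 (′-flipˡ w′≤𝟘))
    where
    w′≤𝟘 : w ′ ≤ 𝟘
    w′≤𝟘 = a∧b≡𝟘 (w ′) (L₂-intro (′-flipˡ (u _ (inj₁ refl))) (′-flipˡ (u _ (inj₂ refl))))

  Min-𝟙⇒≡𝟙 : ∀ {A : Sub P} → Min P A 𝟙 → ∀ w → A w → w ≡ 𝟙
  Min-𝟙⇒≡𝟙 (_ , minimal) w w∈A = minimal w w∈A (𝟙-max w)

  →C≐𝟙 : ∀ {x y} → (∀ w → U₂ P (x ′) y w → w ≡ 𝟙) → →C P x y ≐ ｛ 𝟙 ｝
  →C≐𝟙 only𝟙 = (λ {w} w∈→C → sym (only𝟙 w (proj₁ w∈→C)))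
                      , λ { refl → (λ z _ → 𝟙-max z) , λ w w∈U _ → only𝟙 w w∈U }

  Boolean⇒CondII : BooleanWith′ P → CondII P
  Boolean⇒CondII (distrib , _ , complement) x y (_ , 𝟙∈→C) =
    proj₁ (distrib (x ′) y x) x-below y y-above
    where
    x-below : Lo P (_∪₁_ P (U₂ P (x ′) y) x) x
    x-below w (inj₁ w∈U) = subst (x ≤_) (sym (Min-𝟙⇒≡𝟙 (𝟙∈→C refl) w w∈U)) (𝟙-max x)
    x-below w (inj₂ refl) = ≤-refl
    y-above : Up P (_∪₂_ P (L₂ P (x ′) x) (L₂ P y x)) y
    y-above z (inj₁ z∈L) = proj₁ (proj₁ (complement x)) (L₂-comm z∈L) y (lift tt)
    y-above z (inj₂ z∈L) = z∈L y (inj₁ refl)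

  module _ (condII : CondII P) where

    Disjoint⇒⊥ : ∀ {a b} → Disjoint a b → _⊥_ P a b
    Disjoint⇒⊥ {a} {b} a∧b≡𝟘 = condII a (b ′) (→C≐𝟙 (Disjoint⇒U₂-′≡𝟙 a∧b≡𝟘))

    CondII⇒WeaklyBoolean : WeaklyBoolean P
    CondII⇒WeaklyBoolean a b (_ , a∧b≡𝟘) (_ , a∧b′≡𝟘) = ≤-antisym a≤𝟘 (𝟘-min a)
      where
      a≤b : a ≤ b
      a≤b = subst (a ≤_) (involutive b) (Disjoint⇒⊥ a∧b′≡𝟘)
      a≤𝟘 : a ≤ 𝟘
      a≤𝟘 = a∧b≡𝟘 a (L₂-intro ≤-refl a≤b)

    CondII⇒Paraorthomodular : Paraorthomodular P
    CondII⇒Paraorthomodular x y x≤y (_ , x′∧y≡𝟘) =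
      ≤-antisym x≤y (subst (y ≤_) (involutive x) (′-flipʳ (Disjoint⇒⊥ x′∧y≡𝟘)))

proposition2 : ∀ {c ℓ : Level} (P : BPAI c ℓ) →
    Orthogonal P → LubComplete P →
    (BooleanWith′ P → CondII P) × (CondII P → WeaklyBoolean P × Paraorthomodular P)
proposition2 P _ _ =
  Boolean⇒CondII P , λ condII → CondII⇒WeaklyBoolean P condII , CondII⇒Paraorthomodular P condII
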